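{- Let $\Gamma\cup\{\varphi,\psi\}$ be formulas and $\delta\in\{\varphi,\psi\}$. If $\Gamma,\varphi\lor\psi,\delta\vdash_{\mathsf{R}'_{\mathrm{BK}}}\neg\delta$, then $\Gamma,\varphi\lor\psi\vdash_{\mathsf{R}'_{\mathrm{BK}}}\neg\delta$.
   Context: Formulas are built from a countably infinite set of variables with binary $\land,\lor$ and unary $\neg$. Set-Fmla Hilbert systems: rule schemas $\gamma_1,\dots,\gamma_m/\varphi$ with all substitution instances; $\Gamma\vdash_{\mathsf R}\varphi$ iff some finite sequence ending in $\varphi$ has each member in $\Gamma$ or the conclusion of a rule instance whose premises occur earlier. The $\lor$-lifted version of a rule $\gamma_1,\dots,\gamma_m/\varphi$ is $s\lor\gamma_1,\dots,s\lor\gamma_m/s\lor\varphi$ with $s$ a variable not occurring in the rule. $\mathsf{R}'_{\mathrm{BK}}$ has rule schemas ($p,q,r$ distinct): (1$\star$) $p,\neg p/q$; (2) $p/\neg\neg p$; (3) $\neg\neg p/p$; (4) $p,q/p\land q$; (5) $\neg p,\neg q/\neg(p\land q)$; (6) $\neg p,q/\neg(p\land q)$; (7) $p,\neg q/\neg(p\land q)$; (8$\star$) $\neg(p\land q)/\neg p\lor p$; (9$\star$) $\neg(p\land q)/\neg q\lor q$; (10) $p\land q/p$; (11) $p\land q/q$; (12) $\neg p,\neg q/\neg(p\lor q)$; (13) $\neg(p\lor q)/\neg p$; (14) $\neg(p\lor q)/\neg q$; (15$\star$) $p\lor q/p\lor\neg p$; (16$\star$) $p\lor q/q\lor\neg q$;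 (17) $\neg p,q/p\lor q$; (18) $p,\neg q/p\lor q$; (19) $p,q/p\lor q$; (20) $p\lor q,\neg p/q$; (21) $p\lor(q\lor r)/(p\lor q)\lor r$; (22) $p\lor p/p$; (23) $p\lor q/q\lor p$; (24) $p\lor q,r/\neg p\lor r$; plus the $\lor$-lifted versions of all these except (1$\star$). -}

module Defs where

open import Data.Nat using (ℕ)
open import Data.List using (List; []; _∷_; map)
open import Data.List.Membership.Propositional using (_∈_)
open import Data.List.Relation.Unary.All using (All)
open import Data.Product using (Σ; _×_)
open import Data.Sum using (_⊎_)
open import Relation.Binary.PropositionalEquality using (_≡_)

infixr 6 _∧_
infixr 5 _∨_

data Fmla : Set where
  var : ℕ → Fmla
  _∧_ : Fmla → Fmla → Fmla
  _∨_ : Fmla → Fmla → Fmla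
  ¬   : Fmla → Fmla

-- Substitution instances of rules (2)-(24) of R'_BK.  Since the schema
-- variables p,q,r are distinct variables, a substitution instance is
-- obtained by replacing them with arbitrary formulas.
data Base : List Fmla → Fmla → Set where
  r2  : ∀ p     → Base (p ∷ []) (¬ (¬ p))
  r3  : ∀ p     → Base (¬ (¬ p) ∷ []) p
  r4  : ∀ p q   → Base (p ∷ q ∷ []) (p ∧ q)
  r5  : ∀ p q   → Base (¬ p ∷ ¬ q ∷ []) (¬ (p ∧ q))
  r6  : ∀ p q   → Base (¬ p ∷ q ∷ []) (¬ (p ∧ q))
  r7  : ∀ p q   → Base (p ∷ ¬ q ∷ []) (¬ (p ∧ q))
  r8  : ∀ p q   → Base (¬ (p ∧ q) ∷ []) (¬ p ∨ p)
  r9  : ∀ p q   → Base (¬ (p ∧ q) ∷ []) (¬ q ∨ q)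
  r10 : ∀ p q   → Base ((p ∧ q) ∷ []) p
  r11 : ∀ p q   → Base ((p ∧ q) ∷ []) q
  r12 : ∀ p q   → Base (¬ p ∷ ¬ q ∷ []) (¬ (p ∨ q))
  r13 : ∀ p q   → Base (¬ (p ∨ q) ∷ []) (¬ p)
  r14 : ∀ p q   → Base (¬ (p ∨ q) ∷ []) (¬ q)
  r15 : ∀ p q   → Base ((p ∨ q) ∷ []) (p ∨ ¬ p)
  r16 : ∀ p q   → Base ((p ∨ q) ∷ []) (q ∨ ¬ q)
  r17 : ∀ p q   → Base (¬ p ∷ q ∷ []) (p ∨ q)
  r18 : ∀ p q   → Base (p ∷ ¬ q ∷ []) (p ∨ q)
  r19 : ∀ p q   → Base (p ∷ q ∷ []) (p ∨ q)
  r20 : ∀ p q   → Base ((p ∨ q) ∷ ¬ p ∷ []) q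
  r21 : ∀ p q r → Base ((p ∨ (q ∨ r)) ∷ []) ((p ∨ q) ∨ r)
  r22 : ∀ p     → Base ((p ∨ p) ∷ []) p
  r23 : ∀ p q   → Base ((p ∨ q) ∷ []) (q ∨ p)
  r24 : ∀ p q r → Base ((p ∨ q) ∷ r ∷ []) (¬ p ∨ r)

-- Substitution instances of all rules of R'_BK: rule (1), rules (2)-(24),
-- and the ∨-lifted versions of (2)-(24) (the fresh variable s may be
-- substituted by an arbitrary formula).
data Inst : List Fmla → Fmla → Set where
  r1   : ∀ p q → Inst (p ∷ ¬ p ∷ []) q
  base : ∀ {ps c} → Base ps c → Inst ps c
  lift : ∀ {ps c} (s : Fmla) → Base ps c → Inst (map (s ∨_) ps) (s ∨ c)

FSet : Set₁
FSet = Fmla → Set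

_,,_ : FSet → Fmla → FSet
(Γ ,, φ) χ = Γ χ ⊎ χ ≡ φ
infixl 4 _,,_

-- Valid Γ ds : ds is a derivation from Γ, stored in REVERSE order
-- (the head is the last member); each member is in Γ or the conclusion
-- of a rule instance whose premises occur earlier.
data Valid (Γ : FSet) : List Fmla → Set where
  []   : Valid Γ []
  step : ∀ {φ ds} → Valid Γ ds →
         (Γ φ ⊎ Σ (List Fmla) (λ ps → Inst ps φ × All (_∈ ds) ps)) →
         Valid Γ (φ ∷ ds)

_⊢_ : FSet → Fmla → Set
Γ ⊢ φ = Σ (List Fmla) (λ ds → Valid Γ (φ ∷ ds))
infix 3 _⊢_

-- Let δ be a disjunct of φ ∨ ψ; then rule (15) or (16) derives δ ∨ ¬ δ from φ ∨ ψ.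
-- With δ ∨ ¬ δ at hand, every line χ of a derivation from Γ, δ can be replaced by
-- ¬ δ ∨ χ over Γ alone: members of Γ by rule (24) applied to δ ∨ ¬ δ, δ itself by
-- commuting δ ∨ ¬ δ, and rule applications by the ∨-lifted rules, with ¬ δ as the
-- side disjunct.  The only rule without a lifted version is explosion (1), but
-- from ¬ δ ∨ p and ¬ δ ∨ ¬ p the formula ¬ δ itself is derivable.  The last line
-- then yields ¬ δ ∨ ¬ δ, and rule (22) gives ¬ δ.
module Submission where

open import Defs
open import Data.List using (List; []; _∷_; map; _++_)
open import Data.List.Membership.Propositional using (_∈_)
open import Data.List.Membership.Propositional.Properties using (∈-++⁺ˡ; ∈-++⁺ʳ)
open import Data.List.Relation.Unary.All as All using (All; []; _∷_)
open import Data.List.Relation.Unary.All.Properties using (map⁺; map⁻)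
open import Data.List.Relation.Unary.Any using (here)
open import Data.Product using (Σ; _×_; _,_)
open import Data.Sum using (_⊎_; inj₁; inj₂)
open import Relation.Binary.PropositionalEquality using (_≡_; refl)

Valid-++ : ∀ {Γ} xs {ys} → Valid Γ xs → Valid Γ ys → Valid Γ (xs ++ ys)
Valid-++ []       []                          w = w
Valid-++ (_ ∷ xs) (step v (inj₁ γ))           w = step (Valid-++ xs v w) (inj₁ γ)
Valid-++ (_ ∷ xs) (step v (inj₂ (ps , r , m))) w =
  step (Valid-++ xs v w) (inj₂ (ps , r , All.map ∈-++⁺ˡ m))

merge-derivations : ∀ {Γ ps} → All (Γ ⊢_) ps →
                    Σ (List Fmla) (λ ds → Valid Γ ds × All (_∈ ds) ps)
merge-derivations [] = [] , [] , []
merge-derivations {ps = p ∷ _} ((e , v) ∷ rest) with merge-derivations rest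
... | ds , w , m = (p ∷ e) ++ ds , Valid-++ (p ∷ e) v w ,
                   here refl ∷ All.map (∈-++⁺ʳ (p ∷ e)) m

infer : ∀ {Γ ps c} → Inst ps c → All (Γ ⊢_) ps → Γ ⊢ c
infer r ds with merge-derivations ds
... | es , v , m = es , step v (inj₂ (_ , r , m))

assumption : ∀ {Γ : FSet} {φ} → Γ φ → Γ ⊢ φ
assumption γ = [] , step [] (inj₁ γ)

module _ {Γ : FSet} where

  ∨-comm : ∀ {a b} → Γ ⊢ a ∨ b → Γ ⊢ b ∨ a
  ∨-comm {a} {b} d = infer (base (r23 a b)) (d ∷ [])

  ∨-assocˡ : ∀ {a b c} → Γ ⊢ a ∨ (b ∨ c) → Γ ⊢ (a ∨ b) ∨ c
  ∨-assocˡ {a} {b} {c} d = infer (base (r21 a b c)) (d ∷ [])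

  ∨-assocʳ : ∀ {a b c} → Γ ⊢ (a ∨ b) ∨ c → Γ ⊢ a ∨ (b ∨ c)
  ∨-assocʳ d = ∨-comm (∨-assocˡ (∨-comm (∨-assocˡ (∨-comm d))))

  ∨-explosion : ∀ {s p} → Γ ⊢ s ∨ p → Γ ⊢ s ∨ ¬ p → Γ ⊢ s
  ∨-explosion {s} {p} sp s¬p = infer (base (r22 s)) (s∨s ∷ [])
    where
    s∨¬¬p : Γ ⊢ s ∨ ¬ (¬ p)
    s∨¬¬p = infer (lift s (r2 p)) (sp ∷ [])
    ¬p∨s : Γ ⊢ ¬ p ∨ s
    ¬p∨s = ∨-comm s¬p
    s∨¬p∨s : Γ ⊢ s ∨ (¬ p ∨ s)
    s∨¬p∨s = ∨-comm (∨-assocˡ (infer (lift (¬ p) (r19 s s)) (¬p∨s ∷ ¬p∨s ∷ [])))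
    s∨s : Γ ⊢ s ∨ s
    s∨s = infer (lift s (r20 (¬ p) s)) (s∨¬p∨s ∷ s∨¬¬p ∷ [])

  lift-inst : ∀ s {ps c} → Inst ps c → All (λ x → Γ ⊢ s ∨ x) ps →
              (Γ ⊢ s) ⊎ (Γ ⊢ s ∨ c)
  lift-inst s (r1 p q)        (sp ∷ s¬p ∷ []) = inj₁ (∨-explosion sp s¬p)
  lift-inst s (base b)        ds = inj₂ (infer (lift s b) (map⁺ ds))
  lift-inst s (lift {ps} t b) ds =
    inj₂ (∨-assocʳ (infer (lift (s ∨ t) b) (map⁺ (All.map ∨-assocˡ (map⁻ {xs = ps} ds)))))

module _ {Γ : FSet} {δ : Fmla} (excluded-middle : Γ ⊢ δ ∨ ¬ δ) where

  lift-hypothesis : ∀ {χ} → (Γ ,, δ) χ → Γ ⊢ ¬ δ ∨ χ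
  lift-hypothesis {χ} (inj₁ γ)    = infer (base (r24 δ (¬ δ) χ)) (excluded-middle ∷ assumption γ ∷ [])
  lift-hypothesis     (inj₂ refl) = ∨-comm excluded-middle

  lift-lines : ∀ {ds} → Valid (Γ ,, δ) ds → (Γ ⊢ ¬ δ) ⊎ All (λ x → Γ ⊢ ¬ δ ∨ x) ds
  lift-lines [] = inj₂ []
  lift-lines (step v j) with lift-lines v
  ... | inj₁ ¬δ = inj₁ ¬δ
  lift-lines (step v (inj₁ γ)) | inj₂ lifted = inj₂ (lift-hypothesis γ ∷ lifted)
  lift-lines (step v (inj₂ (_ , r , m))) | inj₂ lifted
    with lift-inst (¬ δ) r (All.map (All.lookup lifted) m)
  ... | inj₁ ¬δ = inj₁ ¬δ
  ... | inj₂ d  = inj₂ (d ∷ lifted)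

  refutation : (Γ ,, δ) ⊢ ¬ δ → Γ ⊢ ¬ δ
  refutation (_ , v) with lift-lines v
  ... | inj₁ ¬δ      = ¬δ
  ... | inj₂ (d ∷ _) = infer (base (r22 (¬ δ))) (d ∷ [])

proposition8 : (Γ : FSet) (φ ψ δ : Fmla) → (δ ≡ φ ⊎ δ ≡ ψ) →
    (Γ ,, φ ∨ ψ ,, δ) ⊢ ¬ δ → (Γ ,, φ ∨ ψ) ⊢ ¬ δ
proposition8 Γ φ ψ .φ (inj₁ refl) = refutation (infer (base (r15 φ ψ)) (assumption (inj₂ refl) ∷ []))
proposition8 Γ φ ψ .ψ (inj₂ refl) = refutation (infer (base (r16 φ ψ)) (assumption (inj₂ refl) ∷ []))
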